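{- Let $\Psi_1=\left\langle\begin{pmatrix} 1 & 1\\ 0 & 1\end{pmatrix},\begin{pmatrix} 1 & 0\\ 4 & 1\end{pmatrix}\right\rangle^+$ and $\Psi_2=\left\langle\begin{pmatrix} 1 & 4\\ 0 & 1\end{pmatrix},\begin{pmatrix} 1 & 0\\ 4 & 1\end{pmatrix}\right\rangle^+$. Numerators in the orbit $\Psi_1\begin{pmatrix} 2\\ 3\end{pmatrix}$ have no congruence obstructions, yet cannot be square. Denominators in the orbit $\Psi_2\begin{pmatrix} 3\\ 8\end{pmatrix}$ are only restricted to be $0\pmod{4}$, yet cannot be square. In particular, these are both instances of reciprocity obstructions.
   Context: $\langle A_1,A_2,\ldots\rangle^+$ denotes the monoid multiplicatively generated by the $A_i$ together with the identity. For $\begin{pmatrix} u\\ v\end{pmatrix}$ in an orbit $\Gamma\begin{pmatrix} x\\ y\end{pmatrix}$, $u$ is the numerator and $v$ the denominator. An orbit exhibits a congruence obstruction modulo $n$ if the residues modulo $n$ of its numerators (resp. denominators) are not all residues modulo $n$. A reciprocity obstruction means the numerators (resp. denominators) include squares modulo every $n\ge1$ but contain no integer squares. -}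

module Defs where

open import Data.Integer using (ℤ; +_; _+_; _*_; _-_; _≥_)
open import Data.Integer.Divisibility using (_∣_)
open import Data.List using (List; _∷_; [])
open import Data.List.Membership.Propositional using (_∈_)
open import Data.Product using (_×_; _,_; ∃; ∃-syntax)

record Mat2 : Set where
  constructor mat
  field a b c d : ℤ

record Vec2 : Set where
  constructor vec
  field num den : ℤ

open Mat2
open Vec2 public

I₂ : Mat2
I₂ = mat (+ 1) (+ 0) (+ 0) (+ 1)

_⊗_ : Mat2 → Mat2 → Mat2
mat a b c d ⊗ mat a' b' c' d' =
  mat (a * a' + b * c') (a * b' + b * d') (c * a' + d * c') (c * b' + d * d')

_·_ : Mat2 → Vec2 → Vec2
mat a b c d · vec x y = vec (a * x + b * y) (c * x + d * y)

data InMonoid (gens : List Mat2) : Mat2 → Set where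
  mon-id  : InMonoid gens I₂
  mon-gen : ∀ {A} → A ∈ gens → InMonoid gens A
  mon-mul : ∀ {γ δ} → InMonoid gens γ → InMonoid gens δ → InMonoid gens (γ ⊗ δ)

InOrbit : List Mat2 → Vec2 → Vec2 → Set
InOrbit gens x w = ∃[ γ ] (InMonoid gens γ × w ≡ γ · x)
  where open import Relation.Binary.PropositionalEquality using (_≡_)

IsSquare : ℤ → Set
IsSquare u = ∃[ k ] (u ≡ k * k)
  where open import Relation.Binary.PropositionalEquality using (_≡_)

Ψ₁ : List Mat2
Ψ₁ = mat (+ 1) (+ 1) (+ 0) (+ 1) ∷ mat (+ 1) (+ 0) (+ 4) (+ 1) ∷ []

Ψ₂ : List Mat2
Ψ₂ = mat (+ 1) (+ 4) (+ 0) (+ 1) ∷ mat (+ 1) (+ 0) (+ 4) (+ 1) ∷ []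

{-# OPTIONS --safe #-}
-- For odd b = 2h + 1 coprime to a, the parity of gauss a h (the number of x ∈ [1, h] with a·x mod b > h)
-- is the Jacobi symbol (a / b) by Gauss' lemma. On the orbit Ψ₁ (2 ; 3) the symbol (u / v) stays -1:
-- the move u ↦ u + v keeps it by periodicity, and v ↦ 4u + v by reciprocity, proved through Eisenstein's
-- lattice-point count. On Ψ₂ (3 ; 8) the same holds for (v / u), and 4 ∣ v. A square k² is never such a
-- non-residue, since pairing x with the reflected residue of k·x makes gauss (k²) h even. For the
-- congruence statements, an orbit entry coprime to n makes the other entry run through an arithmetic
-- progression whose step is invertible modulo n.
module Submission where

module FiniteSums where

  open import Data.Nat.Base
  open import Data.Nat.Properties
  open import Data.Nat.Tactic.RingSolver using (solve-∀)
  open import Data.Product using (_×_; _,_)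
  open import Data.Sum using (_⊎_; inj₁; inj₂)
  open import Relation.Nullary using (¬_; Dec; yes; no; contradiction)
  open import Relation.Binary.PropositionalEquality
  open import Relation.Binary.Definitions using (tri<; tri≈; tri>)

  𝟙 : ∀ {p} {P : Set p} → Dec P → ℕ
  𝟙 (yes _) = 1
  𝟙 (no _)  = 0

  module _ {p} {P : Set p} where

    𝟙-yes : (d : Dec P) → P → 𝟙 d ≡ 1
    𝟙-yes (yes _) _  = refl
    𝟙-yes (no ¬p) p = contradiction p ¬p

    𝟙-no : (d : Dec P) → ¬ P → 𝟙 d ≡ 0
    𝟙-no (yes p) ¬p = contradiction p ¬p
    𝟙-no (no _)  _  = refl

  𝟙-<-trichotomy : ∀ {m n} → m ≢ n → 𝟙 (m <? n) + 𝟙 (n <? m) ≡ 1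
  𝟙-<-trichotomy {m} {n} m≢n with <-cmp m n
  ... | tri< m<n _ n≮m = cong₂ _+_ (𝟙-yes (m <? n) m<n) (𝟙-no (n <? m) n≮m)
  ... | tri≈ _ m≡n _   = contradiction m≡n m≢n
  ... | tri> m≮n _ n<m = cong₂ _+_ (𝟙-no (m <? n) m≮n) (𝟙-yes (n <? m) n<m)

  -- The summation index starts at 1: ∑ n f = f 1 + ⋯ + f n.
  ∑ : ℕ → (ℕ → ℕ) → ℕ
  ∑ zero    f = 0
  ∑ (suc n) f = ∑ n f + f (suc n)

  syntax ∑ n (λ x → e) = ∑[ x ≤ n ] e

  _∈[1,_] : ℕ → ℕ → Set
  x ∈[1, n ] = 1 ≤ x × x ≤ n

  ∈[1,suc] : ∀ {x n} → x ∈[1, n ] → x ∈[1, suc n ]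
  ∈[1,suc] (1≤x , x≤n) = 1≤x , m≤n⇒m≤1+n x≤n

  top∈[1,suc] : ∀ n → suc n ∈[1, suc n ]
  top∈[1,suc] n = s≤s z≤n , ≤-refl

  ∑-cong : ∀ n {f g : ℕ → ℕ} → (∀ {x} → x ∈[1, n ] → f x ≡ g x) → ∑ n f ≡ ∑ n g
  ∑-cong zero    f≗g = refl
  ∑-cong (suc n) f≗g = cong₂ _+_ (∑-cong n (λ x∈ → f≗g (∈[1,suc] x∈))) (f≗g (top∈[1,suc] n))

  ∑-const : ∀ n c → ∑[ _ ≤ n ] c ≡ n * c
  ∑-const zero    c = refl
  ∑-const (suc n) c = trans (cong (_+ c) (∑-const n c)) (+-comm (n * c) c)

  ∑-zero : ∀ n {f : ℕ → ℕ} → (∀ {x} → x ∈[1, n ] → f x ≡ 0) → ∑ n f ≡ 0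
  ∑-zero n f≗0 = trans (∑-cong n f≗0) (trans (∑-const n 0) (*-zeroʳ n))

  ∑-distrib-+ : ∀ n (f g : ℕ → ℕ) → ∑[ x ≤ n ] (f x + g x) ≡ ∑ n f + ∑ n g
  ∑-distrib-+ zero    f g = refl
  ∑-distrib-+ (suc n) f g =
    trans (cong (_+ (f (suc n) + g (suc n))) (∑-distrib-+ n f g))
          (interchange (∑ n f) (∑ n g) (f (suc n)) (g (suc n)))
    where
    interchange : ∀ a b c d → a + b + (c + d) ≡ a + c + (b + d)
    interchange = solve-∀

  ∑-*ˡ : ∀ n c (f : ℕ → ℕ) → ∑[ x ≤ n ] (c * f x) ≡ c * ∑ n f
  ∑-*ˡ zero    c f = sym (*-zeroʳ c)
  ∑-*ˡ (suc n) c f =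
    trans (cong (_+ c * f (suc n)) (∑-*ˡ n c f)) (sym (*-distribˡ-+ c (∑ n f) (f (suc n))))

  ∑-*ʳ : ∀ n c (f : ℕ → ℕ) → ∑[ x ≤ n ] (f x * c) ≡ ∑ n f * c
  ∑-*ʳ n c f = trans (∑-cong n (λ {x} _ → *-comm (f x) c)) (trans (∑-*ˡ n c f) (*-comm c (∑ n f)))

  ∑-comm : ∀ m n (f : ℕ → ℕ → ℕ) → ∑[ x ≤ m ] ∑[ y ≤ n ] f x y ≡ ∑[ y ≤ n ] ∑[ x ≤ m ] f x y
  ∑-comm zero    n f = sym (∑-zero n (λ _ → refl))
  ∑-comm (suc m) n f =
    trans (cong (_+ ∑[ y ≤ n ] f (suc m) y) (∑-comm m n f))
          (sym (∑-distrib-+ n (λ y → ∑[ x ≤ m ] f x y) (f (suc m))))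

  ∑-≤ : ∀ n {f : ℕ → ℕ} {c} → (∀ {x} → x ∈[1, n ] → f x ≤ c) → ∑ n f ≤ n * c
  ∑-≤ zero    f≤c = z≤n
  ∑-≤ (suc n) {c = c} f≤c =
    ≤-trans (+-mono-≤ (∑-≤ n (λ x∈ → f≤c (∈[1,suc] x∈))) (f≤c (top∈[1,suc] n)))
            (≤-reflexive (+-comm (n * c) c))

  ∑-select : ∀ n {t} (g : ℕ → ℕ) → t ∈[1, n ] → ∑[ y ≤ n ] (𝟙 (t ≟ y) * g y) ≡ g t
  ∑-select zero    g (1≤t , t≤0) = contradiction (≤-trans 1≤t t≤0) λ ()
  ∑-select (suc n) {t} g (1≤t , t≤1+n) with m≤n⇒m<n∨m≡n t≤1+n
  ... | inj₁ t<1+n = begin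
    ∑[ y ≤ n ] (𝟙 (t ≟ y) * g y) + 𝟙 (t ≟ suc n) * g (suc n)
      ≡⟨ cong₂ _+_ (∑-select n g (1≤t , ≤-pred t<1+n))
                   (cong (_* g (suc n)) (𝟙-no (t ≟ suc n) (<⇒≢ t<1+n))) ⟩
    g t + 0
      ≡⟨ +-identityʳ (g t) ⟩
    g t ∎
    where open ≡-Reasoning
  ... | inj₂ refl = begin
    ∑[ y ≤ n ] (𝟙 (suc n ≟ y) * g y) + 𝟙 (suc n ≟ suc n) * g (suc n)
      ≡⟨ cong₂ _+_ (∑-zero n (λ {y} (_ , y≤n) → cong (_* g y) (𝟙-no (suc n ≟ y) (>⇒≢ (s≤s y≤n)))))
                   (cong (_* g (suc n)) (𝟙-yes (suc n ≟ suc n) refl)) ⟩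
    g (suc n) + 0
      ≡⟨ +-identityʳ (g (suc n)) ⟩
    g (suc n) ∎
    where open ≡-Reasoning

  module _ {q X F : ℕ} (qF<X : q * F < X) (X≤q[1+F] : X ≤ q * suc F) where

    ∑-𝟙-<-⊓ : ∀ m → ∑[ y ≤ m ] 𝟙 (q * y <? X) ≡ m ⊓ F
    ∑-𝟙-<-⊓ zero    = refl
    ∑-𝟙-<-⊓ (suc m) with F ≤? m
    ... | yes F≤m = begin
      ∑[ y ≤ m ] 𝟙 (q * y <? X) + 𝟙 (q * suc m <? X)
        ≡⟨ cong₂ _+_ (∑-𝟙-<-⊓ m) (𝟙-no (q * suc m <? X) (≤⇒≯ X≤q[1+m])) ⟩
      m ⊓ F + 0
        ≡⟨ trans (+-identityʳ (m ⊓ F)) (m≥n⇒m⊓n≡n F≤m) ⟩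
      F
        ≡⟨ sym (m≥n⇒m⊓n≡n (m≤n⇒m≤1+n F≤m)) ⟩
      suc m ⊓ F ∎
      where
      open ≡-Reasoning
      X≤q[1+m] : X ≤ q * suc m
      X≤q[1+m] = ≤-trans X≤q[1+F] (*-monoʳ-≤ q (s≤s F≤m))
    ... | no F≰m = begin
      ∑[ y ≤ m ] 𝟙 (q * y <? X) + 𝟙 (q * suc m <? X)
        ≡⟨ cong₂ _+_ (∑-𝟙-<-⊓ m) (𝟙-yes (q * suc m <? X) q[1+m]<X) ⟩
      m ⊓ F + 1
        ≡⟨ cong (_+ 1) (m≤n⇒m⊓n≡m (<⇒≤ m<F)) ⟩
      m + 1
        ≡⟨ trans (+-comm m 1) (sym (m≤n⇒m⊓n≡m m<F)) ⟩
      suc m ⊓ F ∎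
      where
      open ≡-Reasoning
      m<F : m < F
      m<F = ≰⇒> F≰m
      q[1+m]<X : q * suc m < X
      q[1+m]<X = ≤-<-trans (*-monoʳ-≤ q m<F) qF<X

    ∑-𝟙-< : ∀ M → F ≤ M → ∑[ y ≤ M ] 𝟙 (q * y <? X) ≡ F
    ∑-𝟙-< M F≤M = trans (∑-𝟙-<-⊓ M) (m≥n⇒m⊓n≡n F≤M)

  private
    +-tight : ∀ {a b n} → a ≤ n → b ≤ 1 → a + b ≡ suc n → a ≡ n × b ≡ 1
    +-tight a≤n z≤n       a+0≡1+n = contradiction (trans (sym (+-identityʳ _)) a+0≡1+n) (<⇒≢ (s≤s a≤n))
    +-tight a≤n (s≤s z≤n) a+1≡1+n = suc-injective (trans (+-comm 1 _) a+1≡1+n) , refl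

  ∑-≤1-tight : ∀ n {f : ℕ → ℕ} → (∀ {x} → x ∈[1, n ] → f x ≤ 1) → ∑ n f ≡ n →
               ∀ {x} → x ∈[1, n ] → f x ≡ 1
  ∑-≤1-tight zero    f≤1 ∑f≡n (1≤x , x≤0) = contradiction (≤-trans 1≤x x≤0) λ ()
  ∑-≤1-tight (suc n) {f} f≤1 ∑f≡1+n {x} (1≤x , x≤1+n) =
    by-position (+-tight ∑f≤n (f≤1 (top∈[1,suc] n)) ∑f≡1+n) (m≤n⇒m<n∨m≡n x≤1+n)
    where
    ∑f≤n : ∑ n f ≤ n
    ∑f≤n = ≤-trans (∑-≤ n (λ x∈ → f≤1 (∈[1,suc] x∈))) (≤-reflexive (*-identityʳ n))
    by-position : ∑ n f ≡ n × f (suc n) ≡ 1 → x < suc n ⊎ x ≡ suc n → f x ≡ 1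
    by-position (∑f≡n , _) (inj₁ x<1+n) =
      ∑-≤1-tight n (λ x∈ → f≤1 (∈[1,suc] x∈)) ∑f≡n (1≤x , ≤-pred x<1+n)
    by-position (_ , f[1+n]≡1) (inj₂ refl) = f[1+n]≡1

  module _ {n : ℕ} {π : ℕ → ℕ}
           (π-range : ∀ {x} → x ∈[1, n ] → π x ∈[1, n ])
           (π-inj : ∀ {x x′} → x ∈[1, n ] → x′ ∈[1, n ] → π x ≡ π x′ → x ≡ x′) where

    private
      fibre : ℕ → ℕ
      fibre y = ∑[ x ≤ n ] 𝟙 (π x ≟ y)

      partial-fibre≤1 : ∀ m y → m ≤ n → ∑[ x ≤ m ] 𝟙 (π x ≟ y) ≤ 1
      partial-fibre≤1 zero    y _   = z≤n
      partial-fibre≤1 (suc m) y m<n with π (suc m) ≟ y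
      ... | no _  = ≤-trans (≤-reflexive (+-identityʳ _)) (partial-fibre≤1 m y (<⇒≤ m<n))
      ... | yes πm≡y = ≤-reflexive (cong (_+ 1) (∑-zero m unhit))
        where
        unhit : ∀ {x} → x ∈[1, m ] → 𝟙 (π x ≟ y) ≡ 0
        unhit (1≤x , x≤m) = 𝟙-no (π _ ≟ y) λ πx≡y → <⇒≢ (s≤s x≤m)
          (π-inj (1≤x , ≤-trans x≤m (<⇒≤ m<n)) (s≤s z≤n , m<n) (trans πx≡y (sym πm≡y)))

      ∑-fibre : ∑ n fibre ≡ n
      ∑-fibre = begin
        ∑[ y ≤ n ] ∑[ x ≤ n ] 𝟙 (π x ≟ y)
          ≡⟨ ∑-comm n n (λ x y → 𝟙 (π x ≟ y)) ⟨
        ∑[ x ≤ n ] ∑[ y ≤ n ] 𝟙 (π x ≟ y)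
          ≡⟨ ∑-cong n (λ x∈ → trans (∑-cong n (λ _ → sym (*-identityʳ _))) (∑-select n (λ _ → 1) (π-range x∈))) ⟩
        ∑[ x ≤ n ] 1
          ≡⟨ trans (∑-const n 1) (*-identityʳ n) ⟩
        n ∎
        where open ≡-Reasoning

      fibre≡1 : ∀ {y} → y ∈[1, n ] → fibre y ≡ 1
      fibre≡1 = ∑-≤1-tight n (λ {y} _ → partial-fibre≤1 n y ≤-refl) ∑-fibre

    ∑-reindex : (g : ℕ → ℕ) → ∑[ x ≤ n ] g (π x) ≡ ∑ n g
    ∑-reindex g = begin
      ∑[ x ≤ n ] g (π x)
        ≡⟨ ∑-cong n (λ x∈ → ∑-select n g (π-range x∈)) ⟨
      ∑[ x ≤ n ] ∑[ y ≤ n ] (𝟙 (π x ≟ y) * g y)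
        ≡⟨ ∑-comm n n (λ x y → 𝟙 (π x ≟ y) * g y) ⟩
      ∑[ y ≤ n ] ∑[ x ≤ n ] (𝟙 (π x ≟ y) * g y)
        ≡⟨ ∑-cong n (λ {y} _ → ∑-*ʳ n (g y) (λ x → 𝟙 (π x ≟ y))) ⟩
      ∑[ y ≤ n ] (fibre y * g y)
        ≡⟨ ∑-cong n (λ {y} y∈ → trans (cong (_* g y) (fibre≡1 y∈)) (+-identityʳ (g y))) ⟩
      ∑ n g ∎
      where open ≡-Reasoning

module ModularArithmetic where

  open import Data.Nat.Base
  open import Data.Nat.Properties
  open import Data.Nat.DivMod
  open import Data.Nat.Divisibility
  open import Data.Nat.Coprimality using (Coprime; coprime-divisor)
  open import Data.Product using (_×_; _,_)
  open import Relation.Nullary using (contradiction)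
  open import Relation.Binary.PropositionalEquality

  %-≡⇒∣∸ : ∀ m o n .{{_ : NonZero n}} → m % n ≡ o % n → n ∣ m ∸ o
  %-≡⇒∣∸ m o n m%n≡o%n = divides (m / n ∸ o / n) (begin
    m ∸ o                                      ≡⟨ cong₂ _∸_ (m≡m%n+[m/n]*n m n) (m≡m%n+[m/n]*n o n) ⟩
    (m % n + m / n * n) ∸ (o % n + o / n * n)  ≡⟨ cong (λ r → (r + m / n * n) ∸ (o % n + o / n * n)) m%n≡o%n ⟩
    (o % n + m / n * n) ∸ (o % n + o / n * n)  ≡⟨ [m+n]∸[m+o]≡n∸o (o % n) (m / n * n) (o / n * n) ⟩
    m / n * n ∸ o / n * n                      ≡⟨ *-distribʳ-∸ n (m / n) (o / n) ⟨
    (m / n ∸ o / n) * n                        ∎)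
    where open ≡-Reasoning

  %-+≡⇒∣+ : ∀ m o n .{{_ : NonZero n}} → m % n + o % n ≡ n → n ∣ m + o
  %-+≡⇒∣+ m o n m%n+o%n≡n = m%n≡0⇒n∣m (m + o) n (begin
    (m + o) % n              ≡⟨ %-distribˡ-+ m o n ⟩
    (m % n + o % n) % n      ≡⟨ cong (_% n) m%n+o%n≡n ⟩
    n % n                    ≡⟨ n%n≡0 n ⟩
    0                        ∎)
    where open ≡-Reasoning

  *-%-congʳ : ∀ k m n .{{_ : NonZero n}} → k * (m % n) % n ≡ k * m % n
  *-%-congʳ k m n = begin
    k * (m % n) % n              ≡⟨ %-distribˡ-* k (m % n) n ⟩
    (k % n) * (m % n % n) % n    ≡⟨ cong (λ r → (k % n) * r % n) (m%n%n≡m%n m n) ⟩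
    (k % n) * (m % n) % n        ≡⟨ %-distribˡ-* k m n ⟨
    k * m % n                    ∎
    where open ≡-Reasoning

  m+2a≡n+2b⇒m%2≡n%2 : ∀ m A n B → m + 2 * A ≡ n + 2 * B → m % 2 ≡ n % 2
  m+2a≡n+2b⇒m%2≡n%2 m A n B m+2A≡n+2B = begin
    m % 2               ≡⟨ [m+kn]%n≡m%n m A 2 ⟨
    (m + A * 2) % 2     ≡⟨ cong (λ t → (m + t) % 2) (*-comm A 2) ⟩
    (m + 2 * A) % 2     ≡⟨ cong (_% 2) m+2A≡n+2B ⟩
    (n + 2 * B) % 2     ≡⟨ cong (λ t → (n + t) % 2) (*-comm 2 B) ⟩
    (n + B * 2) % 2     ≡⟨ [m+kn]%n≡m%n n B 2 ⟩
    n % 2               ∎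
    where open ≡-Reasoning

  pred-/-bounds : ∀ X q .{{_ : NonZero q}} → q * (X / q) < suc X × suc X ≤ q * suc (X / q)
  pred-/-bounds X q =
      s≤s (subst (_≤ X) (*-comm (X / q) q) (m/n*n≤m X q))
    , subst (suc X ≤_) (*-comm (suc (X / q)) q)
        (subst (λ t → suc t ≤ suc (X / q) * q) (sym (m≡m%n+[m/n]*n X q)) (+-monoˡ-≤ (X / q * q) (m%n<n X q)))

  coprime-*+ : ∀ {a b} k → Coprime a b → Coprime a (k * a + b)
  coprime-*+ k a⊥b (d∣a , d∣ka+b) = a⊥b (d∣a , ∣m+n∣m⇒∣n d∣ka+b (∣n⇒∣m*n k d∣a))

  coprime-* : ∀ {a b c} → Coprime a b → Coprime a c → Coprime a (b * c)
  coprime-* a⊥b a⊥c (d∣a , d∣bc) = a⊥c (d∣a , coprime-divisor d⊥b d∣bc)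
    where
    d⊥b : Coprime _ _
    d⊥b (e∣d , e∣b) = a⊥b (∣-trans e∣d d∣a , e∣b)

  coprime-^ : ∀ {a b} e → Coprime a b → Coprime a (b ^ e)
  coprime-^ zero    a⊥b (_ , d∣1) = ∣1⇒≡1 d∣1
  coprime-^ (suc e) a⊥b = coprime-* a⊥b (coprime-^ e a⊥b)

  ∣1+m⇒coprime : ∀ {m n} → n ∣ suc m → Coprime m n
  ∣1+m⇒coprime {m} {n} n∣1+m (d∣m , d∣n) =
    ∣1⇒≡1 (∣m+n∣m⇒∣n (∣-trans d∣n (subst (n ∣_) (+-comm 1 m) n∣1+m)) d∣m)

  ∣∸-small⇒≤ : ∀ {n x y} → x < n → n ∣ x ∸ y → x ≤ y
  ∣∸-small⇒≤ {n} {x} {y} x<n n∣x∸y with x ∸ y in x∸y≡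
  ... | zero  = m∸n≡0⇒m≤n x∸y≡
  ... | suc _ =
    contradiction (≤-trans (∣⇒≤ n∣x∸y) (≤-trans (≤-reflexive (sym x∸y≡)) (m∸n≤m x y))) (<⇒≱ x<n)

  complementary-residues : ∀ {a b n} .{{_ : NonZero n}} → a < n → b < n → 1 ≤ b → n ∣ a + b → a + b ≡ n
  complementary-residues {a} {b} {n} a<n b<n 1≤b (divides q a+b≡qn) with q
  ... | 0 = contradiction a+b≡qn (>⇒≢ (≤-trans 1≤b (m≤n+m b a)))
  ... | 1 = trans a+b≡qn (+-identityʳ n)
  ... | suc (suc q) = contradiction (≤-trans (+-monoʳ-≤ n (m≤m+n n (q * n))) (≤-reflexive (sym a+b≡qn)))
                                    (<⇒≱ (+-mono-<-≤ a<n (<⇒≤ b<n)))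

module GaussCount where

  open import Data.Nat.Base
  open import Data.Nat.Properties
  open import Data.Nat.DivMod
  open import Data.Nat.Divisibility
  open import Data.Nat.Coprimality using (Coprime; coprime-divisor) renaming (sym to coprime-sym)
  open import Data.Nat.Tactic.RingSolver using (solve-∀)
  open import Data.Product using (_×_; _,_; proj₁; proj₂)
  open import Relation.Nullary using (¬_; Dec; yes; no; contradiction)
  open import Relation.Binary.PropositionalEquality
  open FiniteSums
  open ModularArithmetic

  [2_+1] : ℕ → ℕ
  [2 h +1] = suc (2 * h)

  -- By Gauss' lemma (valid for Jacobi symbols), (a / 2h+1) = (-1) ^ gauss a h when a is coprime to 2h+1.
  gauss : ℕ → ℕ → ℕ
  gauss a h = ∑[ x ≤ h ] 𝟙 (h <? a * x % [2 h +1])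

  h<[2h+1] : ∀ h → h < [2 h +1]
  h<[2h+1] h = s≤s (m≤m+n h (h + 0))

  h+h<[2h+1] : ∀ h → h + h < [2 h +1]
  h+h<[2h+1] h = s≤s (≤-reflexive (cong (h +_) (sym (+-identityʳ h))))

  [2h+1]∸[1+h]≡h : ∀ h → [2 h +1] ∸ suc h ≡ h
  [2h+1]∸[1+h]≡h h = trans (m+n∸m≡n h (h + 0)) (+-identityʳ h)

  [2h+1]-shift : ∀ h a → 4 * a + [2 h +1] ≡ [2 (h + 2 * a) +1]
  [2h+1]-shift = expand
    where
    expand : ∀ h a → 4 * a + suc (2 * h) ≡ suc (2 * (h + 2 * a))
    expand = solve-∀

  [2h+1]-coprime-2 : ∀ h → Coprime [2 h +1] 2
  [2h+1]-coprime-2 h = ∣1+m⇒coprime (divides (suc h) (double h))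
    where
    double : ∀ h → suc (suc (2 * h)) ≡ suc h * 2
    double = solve-∀

  gauss-periodic : ∀ a k h → gauss (a + k * [2 h +1]) h ≡ gauss a h
  gauss-periodic a k h = ∑-cong h λ {x} _ → cong (λ r → 𝟙 (h <? r)) (begin
    (a + k * n) * x % n          ≡⟨ cong (_% n) (expand a k n x) ⟩
    (a * x + k * x * n) % n      ≡⟨ [m+kn]%n≡m%n (a * x) (k * x) n ⟩
    a * x % n                    ∎)
    where
    open ≡-Reasoning
    n = [2 h +1]
    expand : ∀ a k n x → (a + k * n) * x ≡ a * x + k * x * n
    expand = solve-∀

  𝟙-complement : ∀ {h} α β → α + β ≡ [2 h +1] → 𝟙 (h <? α) + 𝟙 (h <? β) ≡ 1
  𝟙-complement {h} α β α+β≡n with h <? β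
  ... | yes h<β = cong (_+ 1) (𝟙-no (h <? α) λ h<α → <-irrefl refl
          (subst (_≤ [2 h +1]) (both-large h) (subst (suc h + suc h ≤_) α+β≡n (+-mono-≤ h<α h<β))))
    where
    both-large : ∀ h → suc h + suc h ≡ suc (suc (2 * h))
    both-large = solve-∀
  ... | no h≮β = cong (_+ 0) (𝟙-yes (h <? α) (≰⇒> λ α≤h →
          <-irrefl α+β≡n (≤-<-trans (+-mono-≤ α≤h (≮⇒≥ h≮β)) (h+h<[2h+1] h))))

  abs-residue : ℕ → ℕ → ℕ
  abs-residue h r with h <? r
  ... | yes _ = [2 h +1] ∸ r
  ... | no  _ = r

  abs-residue-≤ : ∀ {h r} → ¬ h < r → abs-residue h r ≡ r
  abs-residue-≤ {h} {r} h≮r with h <? r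
  ... | yes h<r = contradiction h<r h≮r
  ... | no  _   = refl

  abs-residue-> : ∀ {h r} → h < r → abs-residue h r ≡ [2 h +1] ∸ r
  abs-residue-> {h} {r} h<r with h <? r
  ... | yes _   = refl
  ... | no  h≮r = contradiction h<r h≮r

  module _ {a h : ℕ} (a⊥n : Coprime a [2 h +1]) where

    private
      n = [2 h +1]

    ∤-residue : ∀ {x} → x ∈[1, h ] → ¬ n ∣ a * x
    ∤-residue (1≤x , x≤h) n∣ax =
      <⇒≱ (h<[2h+1] h) (≤-trans (∣⇒≤ ⦃ >-nonZero 1≤x ⦄ (coprime-divisor (coprime-sym a⊥n) n∣ax)) x≤h)

    1≤residue : ∀ {x} → x ∈[1, h ] → 1 ≤ a * x % n
    1≤residue x∈ = n≢0⇒n>0 λ r≡0 → ∤-residue x∈ (m%n≡0⇒n∣m _ n r≡0)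

    private
      residue : ℕ → ℕ
      residue x = a * x % n

      sign sign² : ℕ → ℕ
      sign x = 𝟙 (h <? residue x)
      sign² x = 𝟙 (h <? a * a * x % n)

      reflect : ℕ → ℕ
      reflect x = abs-residue h (residue x)

      residue≤n : ∀ x → residue x ≤ n
      residue≤n x = <⇒≤ (m%n<n (a * x) n)

      reflect-range : ∀ {x} → x ∈[1, h ] → reflect x ∈[1, h ]
      reflect-range {x} x∈ = by-sign (h <? residue x)
        where
        by-sign : Dec (h < residue x) → reflect x ∈[1, h ]
        by-sign (yes h<r) = subst (_∈[1, h ]) (sym (abs-residue-> h<r))
          (m<n⇒0<n∸m (m%n<n (a * x) n) , ≤-trans (∸-monoʳ-≤ n h<r) (≤-reflexive ([2h+1]∸[1+h]≡h h)))
        by-sign (no h≮r)  = subst (_∈[1, h ]) (sym (abs-residue-≤ h≮r)) (1≤residue x∈ , ≮⇒≥ h≮r)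

      residue-injective : ∀ {x y} → x ∈[1, h ] → y ∈[1, h ] → residue x ≡ residue y → x ≡ y
      residue-injective x∈ y∈ rx≡ry = ≤-antisym (residue-≡⇒≤ x∈ rx≡ry) (residue-≡⇒≤ y∈ (sym rx≡ry))
        where
        residue-≡⇒≤ : ∀ {x y} → x ∈[1, h ] → residue x ≡ residue y → x ≤ y
        residue-≡⇒≤ {x} {y} (_ , x≤h) rx≡ry =
          ∣∸-small⇒≤ (≤-<-trans x≤h (h<[2h+1] h)) (coprime-divisor (coprime-sym a⊥n)
            (subst (n ∣_) (sym (*-distribˡ-∸ a x y)) (%-≡⇒∣∸ (a * x) (a * y) n rx≡ry)))

      residues-not-opposite : ∀ {x y} → x ∈[1, h ] → y ∈[1, h ] → residue x + residue y ≢ n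
      residues-not-opposite {x} {y} (1≤x , x≤h) (_ , y≤h) rx+ry≡n =
        <⇒≱ (≤-<-trans (+-mono-≤ x≤h y≤h) (h+h<[2h+1] h))
            (∣⇒≤ ⦃ >-nonZero (≤-trans 1≤x (m≤m+n x y)) ⦄ n∣x+y)
        where
        n∣x+y : n ∣ x + y
        n∣x+y = coprime-divisor (coprime-sym a⊥n)
          (subst (n ∣_) (sym (*-distribˡ-+ a x y)) (%-+≡⇒∣+ (a * x) (a * y) n rx+ry≡n))

      reflect-injective : ∀ {x y} → x ∈[1, h ] → y ∈[1, h ] → reflect x ≡ reflect y → x ≡ y
      reflect-injective {x} {y} x∈ y∈ px≡py = by-signs (h <? residue x) (h <? residue y)
        where
        by-signs : Dec (h < residue x) → Dec (h < residue y) → x ≡ y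
        by-signs (no h≮rx) (no h≮ry) =
          residue-injective x∈ y∈ (trans (sym (abs-residue-≤ h≮rx)) (trans px≡py (abs-residue-≤ h≮ry)))
        by-signs (yes h<rx) (yes h<ry) =
          residue-injective x∈ y∈ (∸-cancelˡ-≡ (residue≤n x) (residue≤n y)
            (trans (sym (abs-residue-> h<rx)) (trans px≡py (abs-residue-> h<ry))))
        by-signs (no h≮rx) (yes h<ry) = contradiction
          (trans (cong (_+ residue y) (trans (sym (abs-residue-≤ h≮rx)) (trans px≡py (abs-residue-> h<ry))))
                 (m∸n+n≡m (residue≤n y)))
          (residues-not-opposite x∈ y∈)
        by-signs (yes h<rx) (no h≮ry) = contradiction
          (trans (cong (_+ residue x) (trans (sym (abs-residue-≤ h≮ry)) (trans (sym px≡py) (abs-residue-> h<rx))))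
                 (m∸n+n≡m (residue≤n x)))
          (residues-not-opposite y∈ x∈)

      square-residue : ∀ x → a * a * x % n ≡ a * residue x % n
      square-residue x = trans (cong (_% n) (*-assoc a a x)) (sym (*-%-congʳ a (a * x) n))

      reflect-opposite : ∀ {x} → x ∈[1, h ] → h < residue x → a * a * x % n + a * reflect x % n ≡ n
      reflect-opposite {x} x∈ h<r = trans (cong (_+ a * reflect x % n) (square-residue x))
        (complementary-residues (m%n<n (a * residue x) n) (m%n<n (a * reflect x) n) (1≤residue (reflect-range x∈)) n∣sum)
        where
        open ≡-Reasoning
        n∣sum : n ∣ a * residue x % n + a * reflect x % n
        n∣sum = m%n≡0⇒n∣m _ n (begin
          (a * residue x % n + a * reflect x % n) % n  ≡⟨ %-distribˡ-+ (a * residue x) (a * reflect x) n ⟨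
          (a * residue x + a * reflect x) % n          ≡⟨ cong (_% n) (*-distribˡ-+ a (residue x) (reflect x)) ⟨
          a * (residue x + reflect x) % n              ≡⟨ cong (λ t → a * (residue x + t) % n) (abs-residue-> h<r) ⟩
          a * (residue x + (n ∸ residue x)) % n        ≡⟨ cong (λ t → a * t % n) (m+[n∸m]≡n (residue≤n x)) ⟩
          a * n % n                                    ≡⟨ m*n%n≡0 a n ⟩
          0                                            ∎)

      -- a · reflect x ≡ ±a²x, the sign being that of a·x.
      sign-reflect : ∀ {x} → x ∈[1, h ] → sign² x + 2 * (sign x * sign (reflect x)) ≡ sign x + sign (reflect x)
      sign-reflect {x} x∈ = by-sign (h <? residue x)
        where
        open ≡-Reasoning
        by-sign : Dec (h < residue x) → sign² x + 2 * (sign x * sign (reflect x)) ≡ sign x + sign (reflect x)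
        by-sign (no h≮r) = begin
          sign² x + 2 * (sign x * sign (reflect x))
            ≡⟨ cong (λ s → sign² x + 2 * (s * sign (reflect x))) (𝟙-no (h <? residue x) h≮r) ⟩
          sign² x + 0
            ≡⟨ +-identityʳ _ ⟩
          sign² x
            ≡⟨ cong (λ r → 𝟙 (h <? r)) (trans (square-residue x) (cong (λ r → a * r % n) (sym (abs-residue-≤ h≮r)))) ⟩
          sign (reflect x)
            ≡⟨ cong (_+ sign (reflect x)) (𝟙-no (h <? residue x) h≮r) ⟨
          sign x + sign (reflect x) ∎
        by-sign (yes h<r) = begin
          sign² x + 2 * (sign x * sign (reflect x))
            ≡⟨ cong (λ s → sign² x + 2 * (s * sign (reflect x))) (𝟙-yes (h <? residue x) h<r) ⟩
          sign² x + 2 * (1 * sign (reflect x))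
            ≡⟨ unfold-2* (sign² x) (sign (reflect x)) ⟩
          sign² x + sign (reflect x) + sign (reflect x)
            ≡⟨ cong (_+ sign (reflect x)) (𝟙-complement (a * a * x % n) _ (reflect-opposite x∈ h<r)) ⟩
          1 + sign (reflect x)
            ≡⟨ cong (_+ sign (reflect x)) (𝟙-yes (h <? residue x) h<r) ⟨
          sign x + sign (reflect x) ∎
          where
          unfold-2* : ∀ u s → u + 2 * (1 * s) ≡ u + s + s
          unfold-2* = solve-∀

    gauss-square-even : gauss (a * a) h % 2 ≡ 0
    gauss-square-even = m+2a≡n+2b⇒m%2≡n%2
      (gauss (a * a) h) (∑[ x ≤ h ] (sign x * sign (reflect x))) 0 (gauss a h) (begin
      gauss (a * a) h + 2 * ∑[ x ≤ h ] (sign x * sign (reflect x))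
        ≡⟨ cong (gauss (a * a) h +_) (∑-*ˡ h 2 (λ x → sign x * sign (reflect x))) ⟨
      gauss (a * a) h + ∑[ x ≤ h ] (2 * (sign x * sign (reflect x)))
        ≡⟨ ∑-distrib-+ h _ _ ⟨
      ∑[ x ≤ h ] (sign² x + 2 * (sign x * sign (reflect x)))
        ≡⟨ ∑-cong h sign-reflect ⟩
      ∑[ x ≤ h ] (sign x + sign (reflect x))
        ≡⟨ ∑-distrib-+ h sign (λ x → sign (reflect x)) ⟩
      gauss a h + ∑[ x ≤ h ] sign (reflect x)
        ≡⟨ cong (gauss a h +_) (∑-reindex reflect-range reflect-injective sign) ⟩
      gauss a h + gauss a h
        ≡⟨ cong (gauss a h +_) (+-identityʳ (gauss a h)) ⟨
      0 + 2 * gauss a h ∎)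
      where open ≡-Reasoning

  2r-bounds : ∀ {h r} → 1 ≤ r → r ≤ [2 h +1] →
             [2 h +1] * 𝟙 (h <? r) < 2 * r × 2 * r ≤ [2 h +1] * suc (𝟙 (h <? r))
  2r-bounds {h} {r} 1≤r r≤n with h <? r
  ... | yes h<r = subst (_< 2 * r) (sym (*-identityʳ [2 h +1])) (subst (_≤ 2 * r) (two-more h) (*-monoʳ-≤ 2 h<r))
                , subst (2 * r ≤_) (*-comm 2 [2 h +1]) (*-monoʳ-≤ 2 r≤n)
    where
    two-more : ∀ h → 2 * suc h ≡ suc (suc (2 * h))
    two-more = solve-∀
  ... | no h≮r  = subst (_< 2 * r) (sym (*-zeroʳ [2 h +1])) (≤-trans 1≤r (m≤m+n r (r + 0)))
                , subst (2 * r ≤_) (sym (*-identityʳ [2 h +1])) (m≤n⇒m≤1+n (*-monoʳ-≤ 2 (≮⇒≥ h≮r)))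

  -- That is, ⌊2m / (2h+1)⌋ = 2⌊m / (2h+1)⌋ + [m mod (2h+1) > h] for m = r + q (2h+1).
  2[r+qn]-bounds : ∀ {h r} q → 1 ≤ r → r ≤ [2 h +1] →
    let n = [2 h +1] ; F = 2 * q + 𝟙 (h <? r) in n * F < 2 * (r + q * n) × 2 * (r + q * n) ≤ n * suc F
  2[r+qn]-bounds {h} {r} q 1≤r r≤n with 2r-bounds {h} 1≤r r≤n
  ... | lower , upper =
      (begin-strict
        n * (2 * q + e)      ≡⟨ *-distribˡ-+ n (2 * q) e ⟩
        n * (2 * q) + n * e  <⟨ +-monoʳ-< (n * (2 * q)) lower ⟩
        n * (2 * q) + 2 * r  ≡⟨ shift-lower n q r ⟩
        2 * (r + q * n)      ∎)
    , (begin
        2 * (r + q * n)              ≡⟨ shift-lower n q r ⟨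
        n * (2 * q) + 2 * r          ≤⟨ +-monoʳ-≤ (n * (2 * q)) upper ⟩
        n * (2 * q) + n * suc e      ≡⟨ shift-upper n q e ⟩
        n * suc (2 * q + e)          ∎)
    where
    open ≤-Reasoning
    n = [2 h +1]
    e = 𝟙 (h <? r)
    shift-lower : ∀ n q r → n * (2 * q) + 2 * r ≡ 2 * (r + q * n)
    shift-lower = solve-∀
    shift-upper : ∀ n q e → n * (2 * q) + n * suc e ≡ n * suc (2 * q + e)
    shift-upper = solve-∀

  module _ {M h : ℕ} (a⊥n : Coprime (suc M) [2 h +1]) where

    private
      a = suc M
      n = [2 h +1]

      below above : ℕ → ℕ → ℕ
      below x y = 𝟙 (n * y <? 2 * a * x)
      above x y = 𝟙 (2 * a * x <? n * y)

      ny≢2ax : ∀ {x} y → x ∈[1, h ] → n * y ≢ 2 * a * x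
      ny≢2ax {x} y x∈ ny≡2ax = ∤-residue a⊥n x∈ (coprime-divisor ([2h+1]-coprime-2 h)
        (divides y (trans (sym (*-assoc 2 a x)) (trans (sym ny≡2ax) (*-comm n y)))))

      lattice-count : ∑[ x ≤ h ] ∑[ y ≤ M ] below x y + ∑[ y ≤ M ] ∑[ x ≤ h ] above x y ≡ h * M
      lattice-count = begin
        ∑[ x ≤ h ] ∑[ y ≤ M ] below x y + ∑[ y ≤ M ] ∑[ x ≤ h ] above x y
          ≡⟨ cong (∑[ x ≤ h ] ∑[ y ≤ M ] below x y +_) (∑-comm h M above) ⟨
        ∑[ x ≤ h ] ∑[ y ≤ M ] below x y + ∑[ x ≤ h ] ∑[ y ≤ M ] above x y
          ≡⟨ ∑-distrib-+ h _ _ ⟨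
        ∑[ x ≤ h ] (∑[ y ≤ M ] below x y + ∑[ y ≤ M ] above x y)
          ≡⟨ ∑-cong h (λ x∈ → trans (sym (∑-distrib-+ M _ _)) (∑-cong M (λ {y} _ → 𝟙-<-trichotomy (ny≢2ax y x∈)))) ⟩
        ∑[ x ≤ h ] ∑[ y ≤ M ] 1
          ≡⟨ ∑-cong h (λ _ → trans (∑-const M 1) (*-identityʳ M)) ⟩
        ∑[ x ≤ h ] M
          ≡⟨ ∑-const h M ⟩
        h * M ∎
        where open ≡-Reasoning

      row-count : ∀ {x} → x ∈[1, h ] → ∑[ y ≤ M ] below x y ≡ 2 * (a * x / n) + 𝟙 (h <? a * x % n)
      row-count {x} x∈@(_ , x≤h) = ∑-𝟙-< {n} {2 * a * x} {F} (proj₁ bounds) (proj₂ bounds) M F≤M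
        where
        F = 2 * (a * x / n) + 𝟙 (h <? a * x % n)
        division : 2 * (a * x % n + a * x / n * n) ≡ 2 * a * x
        division = trans (cong (2 *_) (sym (m≡m%n+[m/n]*n (a * x) n))) (sym (*-assoc 2 a x))
        bounds : n * F < 2 * a * x × 2 * a * x ≤ n * suc F
        bounds = subst (λ X → n * F < X × X ≤ n * suc F) division
          (2[r+qn]-bounds (a * x / n) (1≤residue a⊥n x∈) (<⇒≤ (m%n<n (a * x) n)))
        expand : ∀ h M → suc (2 * h) * suc M ≡ suc (2 * suc M * h + M)
        expand = solve-∀
        F≤M : F ≤ M
        F≤M = s≤s⁻¹ (*-cancelˡ-< n F a (begin-strict
          n * F      <⟨ proj₁ bounds ⟩
          2 * a * x  ≤⟨ *-monoʳ-≤ (2 * a) x≤h ⟩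
          2 * a * h  <⟨ subst (2 * a * h <_) (sym (expand h M)) (s≤s (m≤m+n (2 * a * h) M)) ⟩
          n * a      ∎))
          where open ≤-Reasoning

      column-count : ∀ {y} → y ∈[1, M ] → ∑[ x ≤ h ] above x y ≡ (n * y ∸ 1) / (2 * a)
      column-count {suc y} (_ , 1+y≤M) =
        ∑-𝟙-< {2 * a} {n * suc y} {X / (2 * a)} (proj₁ bounds) (proj₂ bounds) h G≤h
        where
        X = n * suc y ∸ 1
        bounds = pred-/-bounds X (2 * a)
        expand : ∀ h M → suc h * (2 * suc M) ≡ suc (suc (2 * h) * M + (M + 2 * h + 1))
        expand = solve-∀
        G≤h : X / (2 * a) ≤ h
        G≤h = s≤s⁻¹ (m<n*o⇒m/o<n (begin-strict
          X              <⟨ ≤-refl ⟩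
          n * suc y      ≤⟨ *-monoʳ-≤ n 1+y≤M ⟩
          n * M          <⟨ subst (n * M <_) (sym (expand h M)) (s≤s (m≤m+n (n * M) _)) ⟩
          suc h * (2 * a) ∎))
          where open ≤-Reasoning

    -- Eisenstein: count the lattice points of [1, h] × [1, M] on either side of the line (2h+1) y = 2 a x.
    eisenstein : 2 * ∑[ x ≤ h ] (a * x / n) + gauss a h + ∑[ y ≤ M ] ((n * y ∸ 1) / (2 * a)) ≡ h * M
    eisenstein = begin
      2 * ∑[ x ≤ h ] (a * x / n) + gauss a h + ∑[ y ≤ M ] ((n * y ∸ 1) / (2 * a))
        ≡⟨ cong₂ _+_ rows (∑-cong M column-count) ⟨
      ∑[ x ≤ h ] ∑[ y ≤ M ] below x y + ∑[ y ≤ M ] ∑[ x ≤ h ] above x y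
        ≡⟨ lattice-count ⟩
      h * M ∎
      where
      open ≡-Reasoning
      rows : ∑[ x ≤ h ] ∑[ y ≤ M ] below x y ≡ 2 * ∑[ x ≤ h ] (a * x / n) + gauss a h
      rows = trans (∑-cong h row-count)
                   (trans (∑-distrib-+ h _ _) (cong (_+ gauss a h) (∑-*ˡ h 2 (λ x → a * x / n))))

  -- Compare the Eisenstein identities for h and h + 2a: the column sums grow by the even number 2 ∑ y.
  gauss-shift : ∀ {M h} → Coprime (suc M) [2 h +1] → gauss (suc M) (h + 2 * suc M) % 2 ≡ gauss (suc M) h % 2
  gauss-shift {M} {h} a⊥n =
    m+2a≡n+2b⇒m%2≡n%2 (gauss a h′) (quotients h′ + ∑[ y ≤ M ] y) (gauss a h) (quotients h + a * M)
      (+-cancelʳ-≡ (floors h) _ _ (begin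
      gauss a h′ + 2 * (quotients h′ + ∑[ y ≤ M ] y) + floors h
        ≡⟨ regroup₁ (gauss a h′) (quotients h′) (∑[ y ≤ M ] y) (floors h) ⟩
      2 * quotients h′ + gauss a h′ + (floors h + 2 * ∑[ y ≤ M ] y)
        ≡⟨ cong (2 * quotients h′ + gauss a h′ +_) floors-shift ⟨
      2 * quotients h′ + gauss a h′ + floors h′
        ≡⟨ eisenstein {M} {h′} a⊥n′ ⟩
      h′ * M
        ≡⟨ regroup₂ h M ⟩
      h * M + 2 * (a * M)
        ≡⟨ cong (_+ 2 * (a * M)) (eisenstein {M} {h} a⊥n) ⟨
      2 * quotients h + gauss a h + floors h + 2 * (a * M)
        ≡⟨ regroup₃ (gauss a h) (quotients h) (floors h) (a * M) ⟩
      gauss a h + 2 * (quotients h + a * M) + floors h ∎))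
    where
    open ≡-Reasoning
    a = suc M
    h′ = h + 2 * a

    quotients floors : ℕ → ℕ
    quotients k = ∑[ x ≤ k ] (a * x / [2 k +1])
    floors k = ∑[ y ≤ M ] (([2 k +1] * y ∸ 1) / (2 * a))

    a⊥n′ : Coprime a [2 h′ +1]
    a⊥n′ = subst (Coprime a) ([2h+1]-shift h a) (coprime-*+ 4 a⊥n)

    floors-shift : floors h′ ≡ floors h + 2 * ∑[ y ≤ M ] y
    floors-shift = trans (∑-cong M step) (trans (∑-distrib-+ M _ _) (cong (floors h +_) (∑-*ˡ M 2 (λ y → y))))
      where
      expand : ∀ h M y → y + 2 * (h + 2 * suc M) * suc y ≡ (y + 2 * h * suc y) + 2 * suc y * (2 * suc M)
      expand = solve-∀
      step : ∀ {y} → y ∈[1, M ] → ([2 h′ +1] * y ∸ 1) / (2 * a) ≡ ([2 h +1] * y ∸ 1) / (2 * a) + 2 * y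
      step {suc y} _ = trans (cong (_/ (2 * a)) (expand h M y))
        (trans (+-distrib-/-∣ʳ ([2 h +1] * suc y ∸ 1) (n∣m*n (2 * suc y)))
               (cong (([2 h +1] * suc y ∸ 1) / (2 * a) +_) (m*n/n≡m (2 * suc y) (2 * a))))

    regroup₁ : ∀ g Q S T → g + 2 * (Q + S) + T ≡ 2 * Q + g + (T + 2 * S)
    regroup₁ = solve-∀
    regroup₂ : ∀ h M → (h + 2 * suc M) * M ≡ h * M + 2 * (suc M * M)
    regroup₂ = solve-∀
    regroup₃ : ∀ g Q T c → 2 * Q + g + T + 2 * c ≡ g + 2 * (Q + c) + T
    regroup₃ = solve-∀

module JacobiSymbol where

  open import Data.Nat.Base
  open import Data.Nat.Properties using (+-comm; 0≢1+n)
  open import Data.Nat.DivMod using (_%_)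
  open import Data.Nat.Divisibility using (∣m⇒∣m*n)
  open import Data.Nat.Coprimality using (Coprime) renaming (sym to coprime-sym)
  open import Data.Product using (_×_; _,_; ∃-syntax)
  open import Relation.Nullary using (¬_)
  open import Relation.Binary.PropositionalEquality
  open ModularArithmetic using (coprime-*+)
  open GaussCount

  JacobiMinusOne : ℕ → ℕ → Set
  JacobiMinusOne a b = ∃[ h ] (b ≡ [2 h +1] × Coprime a b × gauss a h % 2 ≡ 1)

  jacobi-periodic : ∀ {a b} k → JacobiMinusOne a b → JacobiMinusOne (a + k * b) b
  jacobi-periodic {a} {b} k (h , refl , a⊥b , odd) =
    h , refl , coprime-sym (subst (Coprime b) (+-comm (k * b) a) (coprime-*+ k (coprime-sym a⊥b))) ,
    trans (cong (_% 2) (gauss-periodic a k h)) odd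

  jacobi-reciprocity : ∀ {a b} → JacobiMinusOne a b → JacobiMinusOne a (4 * a + b)
  jacobi-reciprocity {zero}  j = j
  jacobi-reciprocity {suc M} (h , refl , a⊥b , odd) =
    h + 2 * suc M , [2h+1]-shift h (suc M) , coprime-*+ 4 a⊥b , trans (gauss-shift {M} {h} a⊥b) odd

  jacobi-non-square : ∀ k {b} → ¬ JacobiMinusOne (k * k) b
  jacobi-non-square k (h , refl , k²⊥b , odd) = 0≢1+n (trans (sym (gauss-square-even {k} {h} k⊥b)) odd)
    where
    k⊥b : Coprime k [2 h +1]
    k⊥b (d∣k , d∣b) = k²⊥b (∣m⇒∣m*n k d∣k , d∣b)

module Orbits where

  open import Defs
  open import Data.Integer.Base as ℤ using (+_)
  import Data.Integer.Properties as ℤ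
  import Data.Integer.Tactic.RingSolver as ℤ-Solver
  open import Data.Nat.Base
  open import Data.Nat.Properties using (+-identityʳ; +-assoc)
  open import Data.Product using (_×_; _,_; ∃-syntax)
  open import Data.List.Base using (_∷_; [])
  open import Data.List.Relation.Unary.Any using (here; there)
  open import Relation.Binary.PropositionalEquality

  upper lower : ℕ → Mat2
  upper k = mat (+ 1) (+ k) (+ 0) (+ 1)
  lower l = mat (+ 1) (+ 0) (+ l) (+ 1)

  -- The orbit of (u₀ , v₀) under ⟨upper k , lower l⟩⁺, described by the moves rather than the matrices.
  data Reachable (k l u₀ v₀ : ℕ) : ℕ → ℕ → Set where
    start      : Reachable k l u₀ v₀ u₀ v₀
    upper-step : ∀ {u v} → Reachable k l u₀ v₀ u v → Reachable k l u₀ v₀ (u + k * v) v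
    lower-step : ∀ {u v} → Reachable k l u₀ v₀ u v → Reachable k l u₀ v₀ u (l * u + v)

  ⊗-· : ∀ γ δ x → (γ ⊗ δ) · x ≡ γ · (δ · x)
  ⊗-· (mat a b c d) (mat a′ b′ c′ d′) (vec x y) =
    cong₂ vec (regroup a b c′ a′ b′ d′ x y) (regroup c d c′ a′ b′ d′ x y)
    where
    regroup : ∀ a b c′ a′ b′ d′ x y →
      (a ℤ.* a′ ℤ.+ b ℤ.* c′) ℤ.* x ℤ.+ (a ℤ.* b′ ℤ.+ b ℤ.* d′) ℤ.* y
        ≡ a ℤ.* (a′ ℤ.* x ℤ.+ b′ ℤ.* y) ℤ.+ b ℤ.* (c′ ℤ.* x ℤ.+ d′ ℤ.* y)
    regroup = ℤ-Solver.solve-∀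

  private
    1x+0y≡x : ∀ x y → + 1 ℤ.* x ℤ.+ + 0 ℤ.* y ≡ x
    1x+0y≡x = ℤ-Solver.solve-∀
    0x+1y≡y : ∀ x y → + 0 ℤ.* x ℤ.+ + 1 ℤ.* y ≡ y
    0x+1y≡y = ℤ-Solver.solve-∀
    1x+ky≡x+ky : ∀ x y k → + 1 ℤ.* x ℤ.+ k ℤ.* y ≡ x ℤ.+ k ℤ.* y
    1x+ky≡x+ky = ℤ-Solver.solve-∀
    lx+1y≡lx+y : ∀ x y l → l ℤ.* x ℤ.+ + 1 ℤ.* y ≡ l ℤ.* x ℤ.+ y
    lx+1y≡lx+y = ℤ-Solver.solve-∀

  I₂-· : ∀ x → I₂ · x ≡ x
  I₂-· (vec x y) = cong₂ vec (1x+0y≡x x y) (0x+1y≡y x y)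

  upper-· : ∀ k u v → upper k · vec (+ u) (+ v) ≡ vec (+ (u + k * v)) (+ v)
  upper-· k u v = cong₂ vec
    (trans (1x+ky≡x+ky (+ u) (+ v) (+ k)) (sym (trans (ℤ.pos-+ u (k * v)) (cong (λ z → + u ℤ.+ z) (ℤ.pos-* k v)))))
    (0x+1y≡y (+ u) (+ v))

  lower-· : ∀ l u v → lower l · vec (+ u) (+ v) ≡ vec (+ u) (+ (l * u + v))
  lower-· l u v = cong₂ vec
    (1x+0y≡x (+ u) (+ v))
    (trans (lx+1y≡lx+y (+ u) (+ v) (+ l)) (sym (trans (ℤ.pos-+ (l * u) v) (cong (ℤ._+ + v) (ℤ.pos-* l u)))))

  module _ {k l u₀ v₀ : ℕ} where

    private
      Γ = upper k ∷ lower l ∷ []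

    monoid-preserves-reachable : ∀ {γ u v} → InMonoid Γ γ → Reachable k l u₀ v₀ u v →
      ∃[ u′ ] ∃[ v′ ] (Reachable k l u₀ v₀ u′ v′ × γ · vec (+ u) (+ v) ≡ vec (+ u′) (+ v′))
    monoid-preserves-reachable mon-id                        r = _ , _ , r , I₂-· _
    monoid-preserves-reachable (mon-gen (here refl))         r = _ , _ , upper-step r , upper-· k _ _
    monoid-preserves-reachable (mon-gen (there (here refl))) r = _ , _ , lower-step r , lower-· l _ _
    monoid-preserves-reachable {u = u} {v} (mon-mul {γ} {δ} γ∈ δ∈) r
      with u₁ , v₁ , r₁ , δx≡ ← monoid-preserves-reachable δ∈ r
      with u₂ , v₂ , r₂ , γδx≡ ← monoid-preserves-reachable γ∈ r₁
      = u₂ , v₂ , r₂ , trans (⊗-· γ δ (vec (+ u) (+ v))) (trans (cong (γ ·_) δx≡) γδx≡)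

    orbit⇒reachable : ∀ {w} → InOrbit Γ (vec (+ u₀) (+ v₀)) w →
      ∃[ u ] ∃[ v ] (Reachable k l u₀ v₀ u v × w ≡ vec (+ u) (+ v))
    orbit⇒reachable (γ , γ∈ , w≡) with u , v , r , γx≡ ← monoid-preserves-reachable γ∈ start =
      u , v , r , trans w≡ γx≡

    reachable⇒orbit : ∀ {u v} → Reachable k l u₀ v₀ u v → InOrbit Γ (vec (+ u₀) (+ v₀)) (vec (+ u) (+ v))
    reachable⇒orbit start = I₂ , mon-id , sym (I₂-· _)
    reachable⇒orbit (upper-step {u} {v} r) with γ , γ∈ , x≡ ← reachable⇒orbit r =
      upper k ⊗ γ , mon-mul (mon-gen (here refl)) γ∈ ,
      sym (trans (⊗-· (upper k) γ _) (trans (cong (upper k ·_) (sym x≡)) (upper-· k u v)))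
    reachable⇒orbit (lower-step {u} {v} r) with γ , γ∈ , x≡ ← reachable⇒orbit r =
      lower l ⊗ γ , mon-mul (mon-gen (there (here refl))) γ∈ ,
      sym (trans (⊗-· (lower l) γ _) (trans (cong (lower l ·_) (sym x≡)) (lower-· l u v)))

    upper-steps : ∀ {u v} t → Reachable k l u₀ v₀ u v → Reachable k l u₀ v₀ (u + t * (k * v)) v
    upper-steps {u} zero    r = subst (λ u′ → Reachable k l u₀ v₀ u′ _) (sym (+-identityʳ u)) r
    upper-steps {u} {v} (suc t) r =
      subst (λ u′ → Reachable k l u₀ v₀ u′ v) (+-assoc u (k * v) (t * (k * v))) (upper-steps t (upper-step r))

    lower-steps : ∀ {u v} t → Reachable k l u₀ v₀ u v → Reachable k l u₀ v₀ u (t * (l * u) + v)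
    lower-steps zero    r = r
    lower-steps {u} {v} (suc t) r =
      subst (Reachable k l u₀ v₀ u) (sym (+-assoc (l * u) (t * (l * u)) v)) (lower-step (lower-steps t r))

module Progressions where

  open import Data.Nat.Base as ℕ using (suc; _^_; _<_; _≤_; s≤s; z≤n; >-nonZero)
  import Data.Nat.Properties as ℕ
  import Data.Nat.DivMod as ℕ
  open import Data.Nat.Induction using (<-rec)
  open import Data.Nat.Coprimality using (Coprime; coprime-Bézout)
  open import Data.Nat.GCD using (module Bézout)
  open import Data.Integer.Base using (ℤ; +_; -_; _+_; _-_; _*_)
  open import Data.Integer.DivMod using (_%ℕ_; _/ℕ_; a≡a%ℕn+[a/ℕn]*n)
  open import Data.Integer.Divisibility.Signed using (_∣_; divides)
  import Data.Integer.Properties as ℤ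
  open import Data.Integer.Tactic.RingSolver using (solve-∀)
  open import Data.Nat.Tactic.RingSolver using () renaming (solve-∀ to ℕ-solve-∀)
  open import Data.Product using (_,_; ∃-syntax)
  open import Relation.Binary.PropositionalEquality
  open GaussCount using ([2_+1])

  private
    pos-1+* : ∀ a b c d → 1 ℕ.+ a ℕ.* b ≡ c ℕ.* d → + 1 + + a * + b ≡ + c * + d
    pos-1+* a b c d e = trans (cong (λ z → + 1 + z) (sym (ℤ.pos-* a b)))
      (trans (sym (ℤ.pos-+ 1 (a ℕ.* b))) (trans (cong +_ e) (ℤ.pos-* c d)))

  coprime⇒inverse : ∀ {u N} → Coprime u N → ∃[ I ] (+ N ∣ I * + u - + 1)
  coprime⇒inverse {u} {N} u⊥N with coprime-Bézout u⊥N
  ... | Bézout.+- x y 1+yN≡xu = + x , divides (+ y) (begin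
    + x * + u - + 1          ≡⟨ cong (_- + 1) (pos-1+* y N x u 1+yN≡xu) ⟨
    + 1 + + y * + N - + 1    ≡⟨ cancel (+ y * + N) ⟩
    + y * + N                ∎)
    where
    open ≡-Reasoning
    cancel : ∀ z → + 1 + z - + 1 ≡ z
    cancel = solve-∀
  ... | Bézout.-+ x y 1+xu≡yN = - + x , divides (- + y) (begin
    - + x * + u - + 1        ≡⟨ negate (+ x) (+ u) ⟩
    - (+ 1 + + x * + u)      ≡⟨ cong -_ (pos-1+* x u y N 1+xu≡yN) ⟩
    - (+ y * + N)            ≡⟨ ℤ.neg-distribˡ-* (+ y) (+ N) ⟩
    - + y * + N              ∎)
    where
    open ≡-Reasoning
    negate : ∀ x u → - x * u - + 1 ≡ - (+ 1 + x * u)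
    negate = solve-∀

  progression-covers : ∀ n (a d r I : ℤ) → + suc n ∣ I * d - + 1 → ∃[ t ] (+ suc n ∣ a + + t * d - r)
  progression-covers n a d r I (divides k Id-1≡kN) = t , divides ((r - a) * k - q * d) (begin
    a + + t * d - r                          ≡⟨ cong (λ s → a + s * d - r) t≡c-qN ⟩
    a + ((r - a) * I - q * N) * d - r        ≡⟨ expand a r I d q N ⟩
    (r - a) * (I * d - + 1) - q * d * N      ≡⟨ cong (λ e → (r - a) * e - q * d * N) Id-1≡kN ⟩
    (r - a) * (k * N) - q * d * N            ≡⟨ factor r a k q d N ⟩
    ((r - a) * k - q * d) * N                ∎)
    where
    open ≡-Reasoning
    N = + suc n
    t = ((r - a) * I) %ℕ suc n
    q = ((r - a) * I) /ℕ suc n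
    rearrange : ∀ t q N → t ≡ t + q * N - q * N
    rearrange = solve-∀
    t≡c-qN : + t ≡ (r - a) * I - q * N
    t≡c-qN = trans (rearrange (+ t) q N) (cong (_- q * N) (sym (a≡a%ℕn+[a/ℕn]*n ((r - a) * I) (suc n))))
    expand : ∀ a r I d q N → a + ((r - a) * I - q * N) * d - r ≡ (r - a) * (I * d - + 1) - q * d * N
    expand = solve-∀
    factor : ∀ r a k q d N → (r - a) * (k * N) - q * d * N ≡ ((r - a) * k - q * d) * N
    factor = solve-∀

  odd-part : ∀ m → 1 ≤ m → ∃[ e ] ∃[ j ] (m ≡ 2 ^ e ℕ.* [2 j +1])
  odd-part = <-rec _ halve
    where
    halve : ∀ m → (∀ {m′} → m′ < m → 1 ≤ m′ → ∃[ e ] ∃[ j ] (m′ ≡ 2 ^ e ℕ.* [2 j +1])) →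
            1 ≤ m → ∃[ e ] ∃[ j ] (m ≡ 2 ^ e ℕ.* [2 j +1])
    halve m rec 1≤m with m ℕ.% 2 | ℕ.m%n<n m 2 | ℕ.m≡m%n+[m/n]*n m 2
    ... | 0 | _ | m≡k*2
      with e , j , k≡ ← rec (ℕ.m/n<m m 2 ⦃ >-nonZero 1≤m ⦄ (s≤s (s≤s z≤n)))
                            (ℕ.n≢0⇒n>0 λ k≡0 → ℕ.<⇒≢ 1≤m (sym (trans m≡k*2 (cong (ℕ._* 2) k≡0))))
      = suc e , j , trans m≡k*2 (trans (cong (ℕ._* 2) k≡) (double (2 ^ e) [2 j +1]))
      where
      double : ∀ a b → a ℕ.* b ℕ.* 2 ≡ 2 ℕ.* a ℕ.* b
      double = ℕ-solve-∀
    ... | 1 | _ | m≡1+k*2 = 0 , m ℕ./ 2 , trans m≡1+k*2 (odd (m ℕ./ 2))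
      where
      odd : ∀ k → 1 ℕ.+ k ℕ.* 2 ≡ 1 ℕ.* suc (2 ℕ.* k)
      odd = ℕ-solve-∀
    ... | suc (suc _) | s≤s (s≤s ()) | _

  coprime-progression-covers : ∀ n {d} → Coprime d (suc n) → ∀ a r → ∃[ t ] (+ suc n ∣ a + + t * + d - r)
  coprime-progression-covers n {d} d⊥N a r with I , I-inverse ← coprime⇒inverse d⊥N =
    progression-covers n a (+ d) r I I-inverse

module OrbitsOfΨ where

  open import Data.Nat.Base
  open import Data.Nat.Properties using (+-comm; *-distribˡ-+)
  open import Data.Nat.Divisibility using (_∣_; divides; ∣m∣n⇒∣m+n; m∣m*n)
  open import Data.Nat.Coprimality using (Coprime)
  open import Data.Nat.Tactic.RingSolver using (solve-∀)
  open import Data.Product using (_×_; _,_; ∃-syntax)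
  open import Relation.Binary.PropositionalEquality
  open ModularArithmetic using (coprime-*; coprime-^; ∣1+m⇒coprime)
  open GaussCount using ([2_+1])
  open JacobiSymbol
  open Orbits
  open Progressions using (odd-part)

  numerator-invariant : ∀ {u v} → Reachable 1 4 2 3 u v → JacobiMinusOne u v
  numerator-invariant start          = 1 , refl , ∣1+m⇒coprime (divides 1 refl) , refl
  numerator-invariant (upper-step r) = jacobi-periodic 1 (numerator-invariant r)
  numerator-invariant (lower-step r) = jacobi-reciprocity (numerator-invariant r)

  denominator-invariant : ∀ {u v} → Reachable 4 4 3 8 u v → JacobiMinusOne v u × 4 ∣ v
  denominator-invariant start = (1 , refl , ∣1+m⇒coprime (divides 3 refl) , refl) , divides 2 refl
  denominator-invariant (upper-step {u} {v} r) with j , 4∣v ← denominator-invariant r =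
    subst (JacobiMinusOne v) (+-comm (4 * v) u) (jacobi-reciprocity j) , 4∣v
  denominator-invariant (lower-step {u} {v} r) with j , 4∣v ← denominator-invariant r =
    subst (λ v′ → JacobiMinusOne v′ u) (+-comm v (4 * u)) (jacobi-periodic 4 j) , ∣m∣n⇒∣m+n (m∣m*n u) 4∣v

  -- The denominator 4(2 + 3n) + 3 is ≡ -1 modulo n + 1.
  Ψ₁-denominator-coprime : ∀ n → ∃[ u ] ∃[ v ] (Reachable 1 4 2 3 u v × Coprime v (suc n))
  Ψ₁-denominator-coprime n =
    P , 4 * P + 3 , lower-step (upper-steps n start) , ∣1+m⇒coprime (divides 12 (twelve n))
    where
    P = 2 + n * (1 * 3)
    twelve : ∀ n → suc (4 * (2 + n * (1 * 3)) + 3) ≡ 12 * suc n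
    twelve = solve-∀

  triangle : ℕ → ℕ
  triangle zero    = 0
  triangle (suc j) = triangle j + suc j

  2*triangle : ∀ j → 2 * triangle j ≡ j * suc j
  2*triangle zero    = refl
  2*triangle (suc j) = begin
    2 * (triangle j + suc j)     ≡⟨ *-distribˡ-+ 2 (triangle j) (suc j) ⟩
    2 * triangle j + 2 * suc j   ≡⟨ cong (_+ 2 * suc j) (2*triangle j) ⟩
    j * suc j + 2 * suc j        ≡⟨ regroup j ⟩
    suc j * suc (suc j)          ∎
    where
    open ≡-Reasoning
    regroup : ∀ j → j * suc j + 2 * suc j ≡ suc j * suc (suc j)
    regroup = solve-∀

  -- The numerator u = 4(2j+1)² - 1 is odd and ≡ -1 modulo the odd part 2j+1 of n+1.
  Ψ₂-numerator-coprime : ∀ n → ∃[ u ] (Reachable 4 4 3 8 u 8 × Coprime u (suc n))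
  Ψ₂-numerator-coprime n with e , j , 1+n≡2^e*M ← odd-part (suc n) (s≤s z≤n) =
    u , upper-steps (triangle j) start , subst (Coprime u) (sym 1+n≡2^e*M) (coprime-* (coprime-^ e u⊥2) u⊥M)
    where
    open ≡-Reasoning
    M = [2 j +1]
    u = 3 + triangle j * (4 * 8)
    1+u≡4MM : suc u ≡ 4 * M * M
    1+u≡4MM = begin
      suc (3 + triangle j * (4 * 8))   ≡⟨ expand (triangle j) ⟩
      4 + 16 * (2 * triangle j)        ≡⟨ cong (λ t → 4 + 16 * t) (2*triangle j) ⟩
      4 + 16 * (j * suc j)             ≡⟨ square j ⟩
      4 * M * M                        ∎
      where
      expand : ∀ t → suc (3 + t * (4 * 8)) ≡ 4 + 16 * (2 * t)
      expand = solve-∀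
      square : ∀ j → 4 + 16 * (j * suc j) ≡ 4 * suc (2 * j) * suc (2 * j)
      square = solve-∀
    u⊥M : Coprime u M
    u⊥M = ∣1+m⇒coprime (divides (4 * M) 1+u≡4MM)
    u⊥2 : Coprime u 2
    u⊥2 = ∣1+m⇒coprime (divides (2 * M * M) (trans 1+u≡4MM (regroup M)))
      where
      regroup : ∀ M → 4 * M * M ≡ 2 * M * M * 2
      regroup = solve-∀

open import Defs
open import Data.Integer using (ℤ; +_; _+_; _*_; _-_; ∣_∣)
open import Data.Integer.Divisibility using (_∣_)
open import Data.Nat using (ℕ; suc)
open import Data.Product using (_×_; _,_; ∃-syntax; proj₁; proj₂; map₂)
open import Relation.Nullary using (¬_)
open import Data.Nat.Coprimality using (Coprime)
import Data.Nat.Base as ℕ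
import Data.Nat.Properties as ℕ
import Data.Integer.Properties as ℤ
open import Data.Integer.Divisibility.Signed using (∣⇒∣ᵤ) renaming (_∣_ to _∣ₛ_; ∣n⇒∣m*n to ∣ₛn⇒∣ₛm*n)
open import Data.Integer.Tactic.RingSolver using (solve-∀)
open import Relation.Binary.PropositionalEquality using (_≡_; refl; sym; trans; cong; subst)
open JacobiSymbol using (JacobiMinusOne; jacobi-non-square)
open Orbits using (Reachable; orbit⇒reachable; reachable⇒orbit; upper-steps; lower-steps)
open Progressions using (coprime-progression-covers)
open OrbitsOfΨ

non-square : ∀ {u} → (∀ k → ¬ u ≡ k ℕ.* k) → ¬ IsSquare (+ u)
non-square u≢k² (k , +u≡k²) = u≢k² ∣ k ∣ (trans (cong ∣_∣ +u≡k²) (ℤ.abs-* k k))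

numerators-not-square : (w : Vec2) → InOrbit Ψ₁ (vec (+ 2) (+ 3)) w → ¬ IsSquare (num w)
numerators-not-square w w∈ with u , v , reach , refl ← orbit⇒reachable w∈ =
  non-square λ k u≡k² →
    jacobi-non-square k (subst (λ a → JacobiMinusOne a v) u≡k² (numerator-invariant reach))

denominators-divisible-by-4 : (w : Vec2) → InOrbit Ψ₂ (vec (+ 3) (+ 8)) w → (+ 4) ∣ den w
denominators-divisible-by-4 w w∈ with u , v , reach , refl ← orbit⇒reachable w∈ =
  proj₂ (denominator-invariant reach)

denominators-not-square : (w : Vec2) → InOrbit Ψ₂ (vec (+ 3) (+ 8)) w → ¬ IsSquare (den w)
denominators-not-square w w∈ with u , v , reach , refl ← orbit⇒reachable w∈ =
  non-square λ k v≡k² →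
    jacobi-non-square k (subst (λ a → JacobiMinusOne a u) v≡k² (proj₁ (denominator-invariant reach)))

numerators-all-residues : (n : ℕ) → (r : ℤ) → ∃[ w ] (InOrbit Ψ₁ (vec (+ 2) (+ 3)) w × (+ suc n) ∣ (num w - r))
numerators-all-residues n r = from-denominator (Ψ₁-denominator-coprime n)
  where
  from-denominator : ∃[ u ] ∃[ v ] (Reachable 1 4 2 3 u v × Coprime v (suc n)) →
                     ∃[ w ] (InOrbit Ψ₁ (vec (+ 2) (+ 3)) w × (+ suc n) ∣ (num w - r))
  from-denominator (u , v , reach , v⊥N) = from-step (coprime-progression-covers n v⊥N (+ u) r)
    where
    from-step : ∃[ t ] (+ suc n ∣ₛ + u + + t * + v - r) →
                ∃[ w ] (InOrbit Ψ₁ (vec (+ 2) (+ 3)) w × (+ suc n) ∣ (num w - r))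
    from-step (t , N∣u+tv-r) =
      vec (+ (u ℕ.+ t ℕ.* (1 ℕ.* v))) (+ v) , reachable⇒orbit (upper-steps t reach) ,
      ∣⇒∣ᵤ (subst (λ z → + suc n ∣ₛ z - r) (sym numerator≡) N∣u+tv-r)
      where
      numerator≡ : + (u ℕ.+ t ℕ.* (1 ℕ.* v)) ≡ + u + + t * + v
      numerator≡ = trans (ℤ.pos-+ u (t ℕ.* (1 ℕ.* v)))
        (cong (λ z → + u + z) (trans (ℤ.pos-* t (1 ℕ.* v)) (cong (λ z → + t * + z) (ℕ.*-identityˡ v))))

denominators-all-residues :
  (n : ℕ) → (m : ℤ) → ∃[ w ] (InOrbit Ψ₂ (vec (+ 3) (+ 8)) w × (+ suc n) ∣ (den w - (+ 4) * m))
denominators-all-residues n m = from-numerator (Ψ₂-numerator-coprime n)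
  where
  from-numerator : ∃[ u ] (Reachable 4 4 3 8 u 8 × Coprime u (suc n)) →
                   ∃[ w ] (InOrbit Ψ₂ (vec (+ 3) (+ 8)) w × (+ suc n) ∣ (den w - (+ 4) * m))
  from-numerator (u , reach , u⊥N) = from-step (coprime-progression-covers n u⊥N (+ 2) m)
    where
    from-step : ∃[ t ] (+ suc n ∣ₛ + 2 + + t * + u - m) →
                ∃[ w ] (InOrbit Ψ₂ (vec (+ 3) (+ 8)) w × (+ suc n) ∣ (den w - (+ 4) * m))
    from-step (t , N∣2+tu-m) =
      vec (+ u) (+ (t ℕ.* (4 ℕ.* u) ℕ.+ 8)) , reachable⇒orbit (lower-steps t reach) ,
      ∣⇒∣ᵤ (subst (+ suc n ∣ₛ_) four-times (∣ₛn⇒∣ₛm*n (+ 4) N∣2+tu-m))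
      where
      distribute : ∀ t u m → + 4 * (+ 2 + t * u - m) ≡ t * (+ 4 * u) + + 8 - + 4 * m
      distribute = solve-∀
      four-times : + 4 * (+ 2 + + t * + u - m) ≡ + (t ℕ.* (4 ℕ.* u) ℕ.+ 8) - + 4 * m
      four-times = trans (distribute (+ t) (+ u) m) (cong (_- + 4 * m) (sym (trans (ℤ.pos-+ (t ℕ.* (4 ℕ.* u)) 8)
        (cong (_+ + 8) (trans (ℤ.pos-* t (4 ℕ.* u)) (cong (+ t *_) (ℤ.pos-* 4 u)))))))

numerators-hit-squares : (n : ℕ) → ∃[ w ] ∃[ k ] (InOrbit Ψ₁ (vec (+ 2) (+ 3)) w × (+ suc n) ∣ (num w - k * k))
numerators-hit-squares n = map₂ (+ 0 ,_) (numerators-all-residues n (+ 0))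

denominators-hit-squares : (n : ℕ) → ∃[ w ] ∃[ k ] (InOrbit Ψ₂ (vec (+ 3) (+ 8)) w × (+ suc n) ∣ (den w - k * k))
denominators-hit-squares n = map₂ (+ 0 ,_) (denominators-all-residues n (+ 0))

theorem2p11 :
  -- Ψ₁ (2;3): numerators hit every residue class mod every n ≥ 1
  ((n : ℕ) → (r : ℤ) → ∃[ w ] (InOrbit Ψ₁ (vec (+ 2) (+ 3)) w × (+ suc n) ∣ (num w - r)))
  -- ... yet no numerator is a square
  × ((w : Vec2) → InOrbit Ψ₁ (vec (+ 2) (+ 3)) w → ¬ IsSquare (num w))
  -- Ψ₂ (3;8): all denominators are 0 mod 4
  × ((w : Vec2) → InOrbit Ψ₂ (vec (+ 3) (+ 8)) w → (+ 4) ∣ den w)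
  -- ... and this is the only congruence restriction: every class of a multiple of 4 mod every n ≥ 1 is hit
  × ((n : ℕ) → (m : ℤ) → ∃[ w ] (InOrbit Ψ₂ (vec (+ 3) (+ 8)) w × (+ suc n) ∣ (den w - (+ 4) * m)))
  -- ... yet no denominator is a square
  × ((w : Vec2) → InOrbit Ψ₂ (vec (+ 3) (+ 8)) w → ¬ IsSquare (den w))
  -- reciprocity obstructions: squares modulo every n ≥ 1 occur among numerators (resp. denominators)
  × ((n : ℕ) → ∃[ w ] ∃[ k ] (InOrbit Ψ₁ (vec (+ 2) (+ 3)) w × (+ suc n) ∣ (num w - k * k)))
  × ((n : ℕ) → ∃[ w ] ∃[ k ] (InOrbit Ψ₂ (vec (+ 3) (+ 8)) w × (+ suc n) ∣ (den w - k * k)))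
theorem2p11 =
  numerators-all-residues , numerators-not-square ,
  denominators-divisible-by-4 , denominators-all-residues , denominators-not-square ,
  numerators-hit-squares , denominators-hit-squares
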